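{- Let $f:[m]\to[n]$ be a surjective map of sets and let $\nu$ be a valuated matroid on $[n]$ of rank $r$ with underlying matroid $N$. Then the function $f^{ -1}(\nu):\binom{[m]}r\to\mathbb T$ defined by $f^{ -1}(\nu)(I)=\nu(f(I))$ if $I$ is a basis of $f^{ -1}(N)$ and $f^{ -1}(\nu)(I)=\infty$ otherwise, is a valuated matroid with underlying matroid $f^{ -1}(N)$.
   Context: $\mathbb T=\mathbb R\cup\{\infty\}$. A valuated matroid of rank $r$ on $E$ is $\nu:\binom Er\to\mathbb T$, not identically $\infty$, such that for all $I,J\in\binom Er$ and $i\in I\setminus J$ there is $j\in J\setminus I$ with $\nu(I)+\nu(J)\ge\nu(I\setminus i\cup j)+\nu(J\setminus j\cup i)$. Its underlying matroid has bases $\{B:\nu(B)\ne\infty\}$. For a map $f:[m]\to[n]$ and a matroid $N$ on $[n]$, the induced matroid $f^{ -1}(N)$ on $[m]$ has rank function $\operatorname{rk}_{f^{ -1}(N)}(A)=\operatorname{rk}_N(f(A))$. -}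

module Defs where

open import Data.Nat using (ℕ; _⊔_; _≟_)
open import Data.Bool using (Bool; true; false; if_then_else_; _∧_)
open import Data.Maybe using (Maybe; just; nothing; is-just)
open import Data.Fin using (Fin)
open import Data.Fin.Subset using (Subset; ⊥; ⊤; ⁅_⁆; _∈_; _∉_; _∩_; _∪_; _-_; ∣_∣; ⋃)
open import Data.Vec using ([]; _∷_; lookup)
open import Data.List as List using (List; []; _∷_; _++_)
open import Data.Product using (_×_; ∃; Σ-syntax; _,_)
open import Relation.Binary.PropositionalEquality using (_≡_; _≢_)
open import Relation.Binary.Structures using (IsTotalOrder)
open import Relation.Nullary using (Dec; does)
open import Relation.Nullary.Decidable using (_×-dec_)
open import Algebra.Core using (Op₁; Op₂)
open import Algebra.Structures using (IsAbelianGroup)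

record OrderedAbelianGroup : Set₁ where
  infixl 6 _+_
  infix 4 _≤_
  field
    Carrier        : Set
    _+_            : Op₂ Carrier
    0#             : Carrier
    neg            : Op₁ Carrier
    _≤_            : Carrier → Carrier → Set
    isAbelianGroup : IsAbelianGroup _≡_ _+_ 0# neg
    isTotalOrder   : IsTotalOrder _≡_ _≤_
    +-monoˡ-≤      : ∀ {a b} c → a ≤ b → a + c ≤ b + c

module _ (G : OrderedAbelianGroup) where
  open OrderedAbelianGroup G

  𝕋 : Set
  𝕋 = Maybe Carrier

  ∞ : 𝕋
  ∞ = nothing

  infixl 6 _⊕_
  _⊕_ : 𝕋 → 𝕋 → 𝕋
  just a ⊕ just b = just (a + b)
  _      ⊕ _      = nothing

  infix 4 _≤𝕋_
  data _≤𝕋_ : 𝕋 → 𝕋 → Set where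
    fin≤fin : ∀ {a b} → a ≤ b → just a ≤𝕋 just b
    _≤∞     : ∀ x → x ≤𝕋 nothing

  -- ν : binom([n], r) → 𝕋, represented as a function on all subsets of
  -- Fin n of which only the values on r-element subsets are relevant.
  IsValuatedMatroid : (n r : ℕ) → (Subset n → 𝕋) → Set
  IsValuatedMatroid n r ν =
    (∃ λ (I : Subset n) → ∣ I ∣ ≡ r × ν I ≢ ∞)
    × (∀ (I J : Subset n) (i : Fin n) → ∣ I ∣ ≡ r → ∣ J ∣ ≡ r → i ∈ I → i ∉ J →
         ∃ λ (j : Fin n) → j ∈ J × j ∉ I ×
           (ν ((I - i) ∪ ⁅ j ⁆) ⊕ ν ((J - j) ∪ ⁅ i ⁆) ≤𝕋 ν I ⊕ ν J))

  allSubsets : ∀ n → List (Subset n)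
  allSubsets ℕ.zero    = [] ∷ []
  allSubsets (ℕ.suc n) = List.map (true ∷_) (allSubsets n) ++ List.map (false ∷_) (allSubsets n)

  isUnderlyingBasis : ∀ {n} (r : ℕ) → (Subset n → 𝕋) → Subset n → Bool
  isUnderlyingBasis r ν B = is-just (ν B) ∧ does (∣ B ∣ ≟ r)

  rankUnderlying : ∀ {n} (r : ℕ) → (Subset n → 𝕋) → Subset n → ℕ
  rankUnderlying {n} r ν A =
    List.foldr _⊔_ 0
      (List.map (λ B → if isUnderlyingBasis r ν B then ∣ A ∩ B ∣ else 0) (allSubsets n))

image : ∀ {m n} → (Fin m → Fin n) → Subset m → Subset n
image {m} f A = ⋃ (List.map (λ i → if lookup A i then ⁅ f i ⁆ else ⊥) (List.allFin m))

inducedRank : ∀ {m n} → (Fin m → Fin n) → (Subset n → ℕ) → Subset m → ℕ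
inducedRank f rkN A = rkN (image f A)

IsBasisRk : ∀ {m} → (Subset m → ℕ) → Subset m → Set
IsBasisRk rk I = rk I ≡ ∣ I ∣ × rk I ≡ rk ⊤

isBasisRk? : ∀ {m} (rk : Subset m → ℕ) (I : Subset m) → Dec (IsBasisRk rk I)
isBasisRk? rk I = (rk I ≟ ∣ I ∣) ×-dec (rk I ≟ rk ⊤)

pullback : (G : OrderedAbelianGroup) → ∀ {m n} → (Fin m → Fin n) → (r : ℕ) →
           (Subset n → 𝕋 G) → Subset m → 𝕋 G
pullback G f r ν I =
  if does (isBasisRk? (inducedRank f (rankUnderlying G r ν)) I)
  then ν (image f I) else ∞ G

module Submission where

-- A set I of size r is a basis of f⁻¹(N) iff f(I) is a basis of N: rk_N(A) is the largest
-- |A ∩ B| over bases B, and rk_N([n]) = r by surjectivity. In particular f is injective on every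
-- basis of f⁻¹(N), f⁻¹(ν)(I) = ν(f(I)) whenever |I| = |f(I)| = r, and a section of f carries a
-- basis of ν to one of f⁻¹(ν). For the exchange axiom at bases I, J and i ∈ I ∖ J: if f(i) ∈ f(J),
-- take j ∈ J with f(j) = f(i); swapping i and j changes neither f(I) nor f(J). Otherwise the
-- exchange axiom of ν at f(I), f(J), f(i) yields some f(j) ∈ f(J) ∖ f(I), and by injectivity the
-- swapped sets map onto the swapped images. If I or J is not a basis the right-hand side is ∞.

open import Defs
open import Data.Nat as ℕ using (ℕ; zero; suc; _≤_; _<_; _⊔_; z≤n; s≤s)
open import Data.Nat.Properties
  using (≡ᵇ⇒≡; ≤-trans; ≤-reflexive; ≤-antisym; <⇒≱; n≮0; n≤0⇒n≡0; n≤1+n; suc-injective;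
         ⊔-sel; ⊔-lub; m≤n⇒m≤n⊔o; m≤n⇒m≤o⊔n; module ≤-Reasoning)
open import Data.Bool using (true; false; if_then_else_)
open import Data.Bool.Properties using (T-≡)
open import Data.Maybe using (just; nothing)
open import Data.Fin using (Fin; zero; suc; _≟_)
open import Data.Fin.Properties using (any?)
open import Data.Fin.Subset
  using (Subset; ⊥; ⊤; ⁅_⁆; _∈_; _∉_; _⊆_; _∩_; _∪_; _─_; _-_; ∣_∣; ⋃; inside; outside)
open import Data.Fin.Subset.Properties
  using (_∈?_; ⊆-antisym; p⊆q⇒∣p∣≤∣q∣; x∈p∪q⁻; x∈p∪q⁺; x∈p∩q⁺; x∈⁅x⁆; x∈⁅y⁆⇒x≡y; ∉⊥; ∈⊤; ⊆⊤;
         ∣⊥∣≡0; ∣p∩q∣≤∣q∣; p∩q⊆p; p∩q⊆q; ∪-identityʳ; p─q⊆p; x∈p∧x≢y⇒x∈p-y; x∈p⇒∣p-x∣<∣p∣;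
         nonempty?)
open import Data.Vec using ([]; _∷_; lookup; here; there)
open import Data.Vec.Properties using ([]=⇒lookup; lookup⇒[]=)
open import Data.List as List using (List; foldr; allFin)
import Data.List.Membership.Propositional as List
open import Data.List.Membership.Propositional.Properties
  using (∈-map⁺; ∈-map⁻; ∈-++⁺ˡ; ∈-++⁺ʳ; ∈-allFin; foldr-selective)
open import Data.List.Properties using (foldr-preservesᵒ; foldr-preservesᵇ)
import Data.List.Relation.Unary.Any as Any
open import Data.List.Relation.Unary.All.Properties using (map⁺)
import Data.List.Relation.Unary.All as All
open import Data.Product using (_×_; _,_; proj₁; proj₂; ∃)
open import Data.Sum using (inj₁; inj₂; [_,_]′)
import Data.Sum as Sum
open import Function using (_∘_)
open import Function.Definitions using (Surjective; StrictlyInverseˡ)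
open import Function.Bundles using (_⇔_; mk⇔; Equivalence)
open import Relation.Binary.PropositionalEquality
  using (_≡_; _≢_; refl; sym; trans; cong; cong₂; subst; subst₂; module ≡-Reasoning)
open import Relation.Binary.Structures using (IsTotalOrder)
open import Relation.Nullary using (¬_; yes; no; contradiction)
open import Relation.Nullary.Decidable using (dec-true; dec-false; _×-dec_; ¬?)

private
  variable
    m n : ℕ
    p q : Subset n
    x y : Fin n

x∈p─q⇒x∉q : x ∈ p ─ q → x ∉ q
x∈p─q⇒x∉q {p = _ ∷ _} {q = outside ∷ _} here ()
x∈p─q⇒x∉q {p = _ ∷ _} {q = _ ∷ _} (there x∈p─q) (there x∈q) = x∈p─q⇒x∉q x∈p─q x∈q

x∉p-x : x ∉ p - x
x∉p-x {x = x} x∈p-x = x∈p─q⇒x∉q x∈p-x (x∈⁅x⁆ x)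

p-x∪⁅x⁆≡p : x ∈ p → (p - x) ∪ ⁅ x ⁆ ≡ p
p-x∪⁅x⁆≡p {x = x} {p = p} x∈p = ⊆-antisym ⊆p p⊆
  where
  ⊆p : (p - x) ∪ ⁅ x ⁆ ⊆ p
  ⊆p {z} z∈ with x∈p∪q⁻ (p - x) ⁅ x ⁆ z∈
  ... | inj₁ z∈p-x = p─q⊆p p ⁅ x ⁆ z∈p-x
  ... | inj₂ z∈⁅x⁆ = subst (_∈ p) (sym (x∈⁅y⁆⇒x≡y x z∈⁅x⁆)) x∈p
  p⊆ : p ⊆ (p - x) ∪ ⁅ x ⁆
  p⊆ {z} z∈p with z ≟ x
  ... | yes refl = x∈p∪q⁺ (inj₂ (x∈⁅x⁆ x))
  ... | no z≢x = x∈p∪q⁺ (inj₁ (x∈p∧x≢y⇒x∈p-y z∈p z≢x))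

∣p∪⁅x⁆∣≡1+∣p∣ : x ∉ p → ∣ p ∪ ⁅ x ⁆ ∣ ≡ suc ∣ p ∣
∣p∪⁅x⁆∣≡1+∣p∣ {x = zero} {p = inside ∷ p} x∉p = contradiction here x∉p
∣p∪⁅x⁆∣≡1+∣p∣ {x = zero} {p = outside ∷ p} _ = cong (suc ∘ ∣_∣) (∪-identityʳ p)
∣p∪⁅x⁆∣≡1+∣p∣ {x = suc x} {p = inside ∷ p} x∉p = cong suc (∣p∪⁅x⁆∣≡1+∣p∣ (x∉p ∘ there))
∣p∪⁅x⁆∣≡1+∣p∣ {x = suc x} {p = outside ∷ p} x∉p = ∣p∪⁅x⁆∣≡1+∣p∣ (x∉p ∘ there)

∣p∪⁅x⁆∣≤1+∣p∣ : ∀ (p : Subset n) x → ∣ p ∪ ⁅ x ⁆ ∣ ≤ suc ∣ p ∣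
∣p∪⁅x⁆∣≤1+∣p∣ p x with x ∈? p
... | no x∉p = ≤-reflexive (∣p∪⁅x⁆∣≡1+∣p∣ x∉p)
... | yes x∈p = ≤-trans (p⊆q⇒∣p∣≤∣q∣ p∪⁅x⁆⊆p) (n≤1+n ∣ p ∣)
  where
  p∪⁅x⁆⊆p : p ∪ ⁅ x ⁆ ⊆ p
  p∪⁅x⁆⊆p z∈ = [ (λ z∈p → z∈p) , (λ z∈⁅x⁆ → subst (_∈ p) (sym (x∈⁅y⁆⇒x≡y x z∈⁅x⁆)) x∈p) ]′
                 (x∈p∪q⁻ p ⁅ x ⁆ z∈)

x∈p⇒1+∣p-x∣≡∣p∣ : x ∈ p → suc ∣ p - x ∣ ≡ ∣ p ∣
x∈p⇒1+∣p-x∣≡∣p∣ {x = x} {p = p} x∈p = begin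
  suc ∣ p - x ∣        ≡⟨ ∣p∪⁅x⁆∣≡1+∣p∣ (x∉p-x {p = p}) ⟨
  ∣ (p - x) ∪ ⁅ x ⁆ ∣  ≡⟨ cong ∣_∣ (p-x∪⁅x⁆≡p x∈p) ⟩
  ∣ p ∣                ∎
  where open ≡-Reasoning

∣p-x∪⁅y⁆∣≡∣p∣ : x ∈ p → y ∉ p - x → ∣ (p - x) ∪ ⁅ y ⁆ ∣ ≡ ∣ p ∣
∣p-x∪⁅y⁆∣≡∣p∣ {x = x} {p = p} x∈p y∉p-x =
  trans (∣p∪⁅x⁆∣≡1+∣p∣ {p = p - x} y∉p-x) (x∈p⇒1+∣p-x∣≡∣p∣ x∈p)

p⊆q∧∣q∣≤∣p∣⇒p≡q : p ⊆ q → ∣ q ∣ ≤ ∣ p ∣ → p ≡ q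
p⊆q∧∣q∣≤∣p∣⇒p≡q {p = p} {q = q} p⊆q ∣q∣≤∣p∣ = ⊆-antisym p⊆q q⊆p
  where
  q⊆p : q ⊆ p
  q⊆p {x} x∈q with x ∈? p
  ... | yes x∈p = x∈p
  ... | no x∉p = contradiction ∣q∣≤∣p∣ (<⇒≱ (begin-strict
      ∣ p ∣      ≤⟨ p⊆q⇒∣p∣≤∣q∣ {p = p} {q = q - x} p⊆q-x ⟩
      ∣ q - x ∣  <⟨ x∈p⇒∣p-x∣<∣p∣ x∈q ⟩
      ∣ q ∣      ∎))
    where
    open ≤-Reasoning
    p⊆q-x : p ⊆ q - x
    p⊆q-x z∈p = x∈p∧x≢y⇒x∈p-y (p⊆q z∈p) λ { refl → x∉p z∈p }

∣p∣≤∣q∣∧p⊈q⇒q⊈p : ∣ p ∣ ≤ ∣ q ∣ → x ∈ p → x ∉ q → ∃ λ y → y ∈ q × y ∉ p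
∣p∣≤∣q∣∧p⊈q⇒q⊈p {p = p} {q = q} {x = x} ∣p∣≤∣q∣ x∈p x∉q
  with any? (λ y → (y ∈? q) ×-dec ¬? (y ∈? p))
... | yes q⊈p = q⊈p
... | no ¬q⊈p = contradiction (subst (x ∈_) (sym (p⊆q∧∣q∣≤∣p∣⇒p≡q q⊆p ∣p∣≤∣q∣)) x∈p) x∉q
  where
  q⊆p : q ⊆ p
  q⊆p {y} y∈q with y ∈? p
  ... | yes y∈p = y∈p
  ... | no y∉p = contradiction (y , y∈q , y∉p) ¬q⊈p

≤-foldr-⊔ : ∀ {k} {ks : List ℕ} → k List.∈ ks → k ≤ foldr _⊔_ 0 ks
≤-foldr-⊔ {ks = ks} k∈ks = foldr-preservesᵒ
  (λ a b → [ m≤n⇒m≤n⊔o b , m≤n⇒m≤o⊔n a ]′) 0 ks (inj₂ (Any.map ≤-reflexive k∈ks))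

module _ (G : OrderedAbelianGroup) where

  open OrderedAbelianGroup G using (isTotalOrder)

  ≤𝕋-refl : ∀ (a : 𝕋 G) → _≤𝕋_ G a a
  ≤𝕋-refl nothing  = _≤∞ nothing
  ≤𝕋-refl (just a) = fin≤fin (IsTotalOrder.refl isTotalOrder)

  ⊕-zeroʳ : ∀ (a : 𝕋 G) → _⊕_ G a (∞ G) ≡ ∞ G
  ⊕-zeroʳ nothing  = refl
  ⊕-zeroʳ (just _) = refl

  ¬≢∞⇒≡∞ : ∀ {a : 𝕋 G} → ¬ a ≢ ∞ G → a ≡ ∞ G
  ¬≢∞⇒≡∞ {nothing} _    = refl
  ¬≢∞⇒≡∞ {just _}  ¬a≢∞ = contradiction (λ ()) ¬a≢∞

  ∈-allSubsets : ∀ (p : Subset n) → p List.∈ allSubsets G n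
  ∈-allSubsets {zero} []              = Any.here refl
  ∈-allSubsets {suc n} (inside ∷ p)  = ∈-++⁺ˡ (∈-map⁺ (inside ∷_) (∈-allSubsets p))
  ∈-allSubsets {suc n} (outside ∷ p) =
    ∈-++⁺ʳ (List.map (inside ∷_) (allSubsets G n)) (∈-map⁺ (outside ∷_) (∈-allSubsets p))

IsUnderlyingBasis : (G : OrderedAbelianGroup) (r : ℕ) → (Subset n → 𝕋 G) → Subset n → Set
IsUnderlyingBasis G r ν B = ∣ B ∣ ≡ r × ν B ≢ ∞ G

ExchangePartner : (G : OrderedAbelianGroup) → (Subset n → 𝕋 G) → Subset n → Subset n → Fin n → Set
ExchangePartner G ν I J i = ∃ λ j → j ∈ J × j ∉ I ×
  _≤𝕋_ G (_⊕_ G (ν ((I - i) ∪ ⁅ j ⁆)) (ν ((J - j) ∪ ⁅ i ⁆))) (_⊕_ G (ν I) (ν J))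

SatisfiesExchange : (G : OrderedAbelianGroup) (r : ℕ) → (Subset n → 𝕋 G) → Set
SatisfiesExchange G r ν =
  ∀ I J i → ∣ I ∣ ≡ r → ∣ J ∣ ≡ r → i ∈ I → i ∉ J → ExchangePartner G ν I J i

module UnderlyingMatroid (G : OrderedAbelianGroup) {n : ℕ} (r : ℕ) (ν : Subset n → 𝕋 G) where

  isUnderlyingBasis⁺ : ∀ B → IsUnderlyingBasis G r ν B → isUnderlyingBasis G r ν B ≡ true
  isUnderlyingBasis⁺ B (∣B∣≡r , νB≢∞) with ν B
  ... | nothing = contradiction refl νB≢∞
  ... | just _  = dec-true (∣ B ∣ ℕ.≟ r) ∣B∣≡r

  isUnderlyingBasis⁻ : ∀ B → isUnderlyingBasis G r ν B ≡ true → IsUnderlyingBasis G r ν B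
  isUnderlyingBasis⁻ B isBasis with ν B
  ... | just _ = ≡ᵇ⇒≡ ∣ B ∣ r (Equivalence.from T-≡ isBasis) , λ ()

  rk : Subset n → ℕ
  rk = rankUnderlying G r ν

  weight : Subset n → Subset n → ℕ
  weight A B = if isUnderlyingBasis G r ν B then ∣ A ∩ B ∣ else 0

  ∣A∩B∣≤rk : ∀ A B → IsUnderlyingBasis G r ν B → ∣ A ∩ B ∣ ≤ rk A
  ∣A∩B∣≤rk A B B-basis = ≤-foldr-⊔ (subst (λ k → k List.∈ _)
    (cong (if_then ∣ A ∩ B ∣ else 0) (isUnderlyingBasis⁺ B B-basis))
    (∈-map⁺ (weight A) (∈-allSubsets G B)))

  rk≤r : ∀ A → rk A ≤ r
  rk≤r A = foldr-preservesᵇ {P = _≤ r} {f = _⊔_} ⊔-lub z≤n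
    (map⁺ (All.universal weight≤r (allSubsets G n)))
    where
    weight≤r : ∀ B → weight A B ≤ r
    weight≤r B with isUnderlyingBasis G r ν B in isBasis
    ... | true  = ≤-trans (∣p∩q∣≤∣q∣ A B) (≤-reflexive (proj₁ (isUnderlyingBasis⁻ B isBasis)))
    ... | false = z≤n

  rk-attained : ∀ {B₀} → IsUnderlyingBasis G r ν B₀ →
                ∀ A → ∃ λ B → IsUnderlyingBasis G r ν B × rk A ≡ ∣ A ∩ B ∣
  -- A fold of ⊔ returns its seed 0 or one of the weights; the value 0 is attained at any basis.
  rk-attained {B₀} B₀-basis A =
    [ attainedAtB₀ , attainedInList ]′
      (foldr-selective ⊔-sel 0 (List.map (weight A) (allSubsets G n)))
    where
    attainedAtB₀ : rk A ≡ 0 → ∃ λ B → IsUnderlyingBasis G r ν B × rk A ≡ ∣ A ∩ B ∣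
    attainedAtB₀ rk≡0 = B₀ , B₀-basis ,
      trans rk≡0 (sym (n≤0⇒n≡0 (subst (∣ A ∩ B₀ ∣ ≤_) rk≡0 (∣A∩B∣≤rk A B₀ B₀-basis))))

    attainedInList : rk A List.∈ List.map (weight A) (allSubsets G n) →
                     ∃ λ B → IsUnderlyingBasis G r ν B × rk A ≡ ∣ A ∩ B ∣
    attainedInList rk∈ with ∈-map⁻ (weight A) rk∈
    ... | B , _ , rk≡weight with isUnderlyingBasis G r ν B in isBasis
    ...   | true  = B , isUnderlyingBasis⁻ B isBasis , rk≡weight
    ...   | false = attainedAtB₀ rk≡weight

  basis⊆A⇒rk≡r : ∀ {A B} → B ⊆ A → IsUnderlyingBasis G r ν B → rk A ≡ r
  basis⊆A⇒rk≡r {A} {B} B⊆A B-basis = ≤-antisym (rk≤r A) (begin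
    r          ≡⟨ proj₁ B-basis ⟨
    ∣ B ∣      ≤⟨ p⊆q⇒∣p∣≤∣q∣ {p = B} {q = A ∩ B} (λ x∈B → x∈p∩q⁺ (B⊆A x∈B , x∈B)) ⟩
    ∣ A ∩ B ∣  ≤⟨ ∣A∩B∣≤rk A B B-basis ⟩
    rk A       ∎)
    where open ≤-Reasoning

∈-⋃⁺ : ∀ {ps : List (Subset n)} → p List.∈ ps → x ∈ p → x ∈ ⋃ ps
∈-⋃⁺ (Any.here refl) x∈p = x∈p∪q⁺ (inj₁ x∈p)
∈-⋃⁺ {ps = q List.∷ _} (Any.there p∈ps) x∈p = x∈p∪q⁺ {p = q} (inj₂ (∈-⋃⁺ p∈ps x∈p))

∈-⋃⁻ : ∀ (ps : List (Subset n)) → x ∈ ⋃ ps → ∃ λ p → p List.∈ ps × x ∈ p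
∈-⋃⁻ List.[] x∈⊥ = contradiction x∈⊥ ∉⊥
∈-⋃⁻ (p List.∷ ps) x∈ with x∈p∪q⁻ p (⋃ ps) x∈
... | inj₁ x∈p = p , Any.here refl , x∈p
... | inj₂ x∈⋃ps with ∈-⋃⁻ ps x∈⋃ps
...   | q , q∈ps , x∈q = q , Any.there q∈ps , x∈q

InjectiveOn : (Fin m → Fin n) → Subset m → Set
InjectiveOn f A = ∀ {a b} → a ∈ A → b ∈ A → f a ≡ f b → a ≡ b

module Image {m n : ℕ} (f : Fin m → Fin n) where

  private
    contribution : Subset m → Fin m → Subset n
    contribution A i = if lookup A i then ⁅ f i ⁆ else ⊥

  ∈-image⁺ : ∀ {A x} → x ∈ A → f x ∈ image f A
  ∈-image⁺ {A} {x} x∈A = ∈-⋃⁺ (∈-map⁺ (contribution A) (∈-allFin x)) fx∈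
    where
    fx∈ : f x ∈ contribution A x
    fx∈ rewrite []=⇒lookup x∈A = x∈⁅x⁆ (f x)

  ∈-image⁻ : ∀ {A y} → y ∈ image f A → ∃ λ x → x ∈ A × f x ≡ y
  ∈-image⁻ {A} y∈ with ∈-⋃⁻ (List.map (contribution A) (allFin m)) y∈
  ... | _ , p∈ , y∈p with ∈-map⁻ (contribution A) p∈
  ... | x , _ , refl with lookup A x in x∈A
  ...   | true  = x , lookup⇒[]= x A x∈A , sym (x∈⁅y⁆⇒x≡y (f x) y∈p)
  ...   | false = contradiction y∈p ∉⊥

  image-∪ : ∀ A B → image f (A ∪ B) ≡ image f A ∪ image f B
  image-∪ A B = ⊆-antisym ⊆∪ ∪⊆
    where
    ⊆∪ : image f (A ∪ B) ⊆ image f A ∪ image f B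
    ⊆∪ y∈ with ∈-image⁻ y∈
    ... | x , x∈A∪B , refl = x∈p∪q⁺ (Sum.map (∈-image⁺ {A}) (∈-image⁺ {B}) (x∈p∪q⁻ A B x∈A∪B))
    ∪⊆ : image f A ∪ image f B ⊆ image f (A ∪ B)
    ∪⊆ y∈ with x∈p∪q⁻ (image f A) (image f B) y∈
    ... | inj₁ y∈fA with ∈-image⁻ y∈fA
    ...   | x , x∈A , refl = ∈-image⁺ {A ∪ B} (x∈p∪q⁺ (inj₁ x∈A))
    ∪⊆ y∈ | inj₂ y∈fB with ∈-image⁻ y∈fB
    ...   | x , x∈B , refl = ∈-image⁺ {A ∪ B} (x∈p∪q⁺ {p = A} (inj₂ x∈B))

  image-⁅⁆ : ∀ x → image f ⁅ x ⁆ ≡ ⁅ f x ⁆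
  image-⁅⁆ x = ⊆-antisym ⊆⁅fx⁆ (λ y∈⁅fx⁆ → subst (_∈ image f ⁅ x ⁆) (sym (x∈⁅y⁆⇒x≡y (f x) y∈⁅fx⁆))
                                                     (∈-image⁺ (x∈⁅x⁆ x)))
    where
    ⊆⁅fx⁆ : image f ⁅ x ⁆ ⊆ ⁅ f x ⁆
    ⊆⁅fx⁆ y∈ with ∈-image⁻ y∈
    ... | z , z∈⁅x⁆ , refl = subst (λ z → f z ∈ ⁅ f x ⁆) (sym (x∈⁅y⁆⇒x≡y x z∈⁅x⁆)) (x∈⁅x⁆ (f x))

  image-∪⁅⁆ : ∀ A x → image f (A ∪ ⁅ x ⁆) ≡ image f A ∪ ⁅ f x ⁆
  image-∪⁅⁆ A x = trans (image-∪ A ⁅ x ⁆) (cong (image f A ∪_) (image-⁅⁆ x))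

  image-remove : ∀ {A x} → InjectiveOn f A → x ∈ A → image f (A - x) ≡ image f A - f x
  image-remove {A} {x} injective x∈A = ⊆-antisym ⊆fA-fx fA-fx⊆
    where
    ⊆fA-fx : image f (A - x) ⊆ image f A - f x
    ⊆fA-fx y∈ with ∈-image⁻ y∈
    ... | a , a∈A-x , refl = x∈p∧x≢y⇒x∈p-y (∈-image⁺ a∈A) fa≢fx
      where
      a∈A = p─q⊆p A ⁅ x ⁆ a∈A-x
      fa≢fx : f a ≢ f x
      fa≢fx fa≡fx = x∉p-x {p = A} (subst (_∈ A - x) (injective a∈A x∈A fa≡fx) a∈A-x)
    fA-fx⊆ : image f A - f x ⊆ image f (A - x)
    fA-fx⊆ y∈ with ∈-image⁻ {A} (p─q⊆p (image f A) ⁅ f x ⁆ y∈)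
    ... | a , a∈A , refl =
      ∈-image⁺ {A - x} (x∈p∧x≢y⇒x∈p-y a∈A λ { refl → x∉p-x {p = image f A} y∈ })

  image-exchange : ∀ {A x} y → InjectiveOn f A → x ∈ A →
                   image f ((A - x) ∪ ⁅ y ⁆) ≡ (image f A - f x) ∪ ⁅ f y ⁆
  image-exchange {A} {x} y injective x∈A =
    trans (image-∪⁅⁆ (A - x) y) (cong (_∪ ⁅ f y ⁆) (image-remove injective x∈A))

  ∣image∣≤∣∣ : ∀ A → ∣ image f A ∣ ≤ ∣ A ∣
  ∣image∣≤∣∣ A = bounded A refl
    where
    bounded : ∀ {k} A → ∣ A ∣ ≡ k → ∣ image f A ∣ ≤ k
    bounded A _ with nonempty? A
    bounded A _ | no ∄x∈A = ≤-trans (p⊆q⇒∣p∣≤∣q∣ fA⊆⊥) (≤-trans (≤-reflexive (∣⊥∣≡0 n)) z≤n)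
      where
      fA⊆⊥ : image f A ⊆ ⊥
      fA⊆⊥ y∈ with ∈-image⁻ y∈
      ... | x , x∈A , _ = contradiction (x , x∈A) ∄x∈A
    bounded {zero} A ∣A∣≡0 | yes (x , x∈A) =
      contradiction (subst (∣ A - x ∣ <_) ∣A∣≡0 (x∈p⇒∣p-x∣<∣p∣ x∈A)) n≮0
    bounded {suc k} A ∣A∣≡1+k | yes (x , x∈A) = begin
      ∣ image f A ∣                  ≡⟨ cong (∣_∣ ∘ image f) (p-x∪⁅x⁆≡p x∈A) ⟨
      ∣ image f ((A - x) ∪ ⁅ x ⁆) ∣  ≡⟨ cong ∣_∣ (image-∪⁅⁆ (A - x) x) ⟩
      ∣ image f (A - x) ∪ ⁅ f x ⁆ ∣  ≤⟨ ∣p∪⁅x⁆∣≤1+∣p∣ (image f (A - x)) (f x) ⟩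
      suc ∣ image f (A - x) ∣        ≤⟨ s≤s (bounded (A - x) ∣A-x∣≡k) ⟩
      suc k                          ∎
      where
      open ≤-Reasoning
      ∣A-x∣≡k : ∣ A - x ∣ ≡ k
      ∣A-x∣≡k = suc-injective (trans (x∈p⇒1+∣p-x∣≡∣p∣ x∈A) ∣A∣≡1+k)

  ∣image∣≡∣∣⇒injectiveOn : ∀ {A} → ∣ image f A ∣ ≡ ∣ A ∣ → InjectiveOn f A
  ∣image∣≡∣∣⇒injectiveOn {A} ∣fA∣≡∣A∣ {a} {b} a∈A b∈A fa≡fb with a ≟ b
  ... | yes a≡b = a≡b
  ... | no a≢b = contradiction ∣fA∣≡∣A∣ (λ eq → <⇒≱ (x∈p⇒∣p-x∣<∣p∣ a∈A) (begin
      ∣ A ∣                ≡⟨ eq ⟨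
      ∣ image f A ∣        ≤⟨ p⊆q⇒∣p∣≤∣q∣ fA⊆fA-a ⟩
      ∣ image f (A - a) ∣  ≤⟨ ∣image∣≤∣∣ (A - a) ⟩
      ∣ A - a ∣            ∎))
    where
    open ≤-Reasoning
    fA⊆fA-a : image f A ⊆ image f (A - a)
    fA⊆fA-a y∈ with ∈-image⁻ {A} y∈
    ... | z , z∈A , refl with z ≟ a
    ...   | yes refl =
      subst (_∈ image f (A - a)) (sym fa≡fb) (∈-image⁺ {A - a} (x∈p∧x≢y⇒x∈p-y b∈A (a≢b ∘ sym)))
    ...   | no z≢a   = ∈-image⁺ {A - a} (x∈p∧x≢y⇒x∈p-y z∈A z≢a)

  image-⊤ : Surjective _≡_ _≡_ f → image f ⊤ ≡ ⊤
  image-⊤ surjective = ⊆-antisym ⊆⊤ λ {y} _ →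
    subst (_∈ image f ⊤) (proj₂ (surjective y) refl) (∈-image⁺ ∈⊤)

image-image-section : ∀ {f : Fin m → Fin n} {g} → StrictlyInverseˡ _≡_ f g →
                      ∀ B → image f (image g B) ≡ B
image-image-section {f = f} {g} f∘g≡id B = ⊆-antisym ⊆B B⊆
  where
  open Image
  ⊆B : image f (image g B) ⊆ B
  ⊆B y∈ with ∈-image⁻ f y∈
  ... | x , x∈gB , refl with ∈-image⁻ g x∈gB
  ...   | z , z∈B , refl = subst (_∈ B) (sym (f∘g≡id z)) z∈B
  B⊆ : B ⊆ image f (image g B)
  B⊆ {y} y∈B = subst (_∈ image f (image g B)) (f∘g≡id y) (∈-image⁺ f (∈-image⁺ g y∈B))

module InducedValuation (G : OrderedAbelianGroup) {m n r : ℕ} (f : Fin m → Fin n)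
  (surjective : Surjective _≡_ _≡_ f) (ν : Subset n → 𝕋 G)
  {B₀ : Subset n} (B₀-basis : IsUnderlyingBasis G r ν B₀) where

  open UnderlyingMatroid G r ν
  open Image f

  rkf⁻¹N : Subset m → ℕ
  rkf⁻¹N = inducedRank f rk

  f⁻¹ν : Subset m → 𝕋 G
  f⁻¹ν = pullback G f r ν

  rkf⁻¹N⊤≡r : rkf⁻¹N ⊤ ≡ r
  rkf⁻¹N⊤≡r = trans (cong rk (image-⊤ surjective)) (basis⊆A⇒rk≡r ⊆⊤ B₀-basis)

  inducedBasis⇔ : ∀ I → IsBasisRk rkf⁻¹N I ⇔ (∣ I ∣ ≡ r × IsUnderlyingBasis G r ν (image f I))
  inducedBasis⇔ I = mk⇔ to from
    where
    to : IsBasisRk rkf⁻¹N I → ∣ I ∣ ≡ r × IsUnderlyingBasis G r ν (image f I)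
    to (rk≡∣I∣ , rk≡rk⊤) with rk-attained B₀-basis (image f I)
    ... | B , B-basis , rk≡∣fI∩B∣ = ∣I∣≡r , subst (IsUnderlyingBasis G r ν) (sym fI≡B) B-basis
      where
      ∣I∣≡r : ∣ I ∣ ≡ r
      ∣I∣≡r = trans (sym rk≡∣I∣) (trans rk≡rk⊤ rkf⁻¹N⊤≡r)
      ∣fI∩B∣≡r : ∣ image f I ∩ B ∣ ≡ r
      ∣fI∩B∣≡r = trans (sym rk≡∣fI∩B∣) (trans rk≡rk⊤ rkf⁻¹N⊤≡r)
      fI∩B≡fI : image f I ∩ B ≡ image f I
      fI∩B≡fI = p⊆q∧∣q∣≤∣p∣⇒p≡q (p∩q⊆p _ B)
        (≤-trans (∣image∣≤∣∣ I) (≤-reflexive (trans ∣I∣≡r (sym ∣fI∩B∣≡r))))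
      fI∩B≡B : image f I ∩ B ≡ B
      fI∩B≡B = p⊆q∧∣q∣≤∣p∣⇒p≡q (p∩q⊆q _ B) (≤-reflexive (trans (proj₁ B-basis) (sym ∣fI∩B∣≡r)))
      fI≡B : image f I ≡ B
      fI≡B = trans (sym fI∩B≡fI) fI∩B≡B
    from : ∣ I ∣ ≡ r × IsUnderlyingBasis G r ν (image f I) → IsBasisRk rkf⁻¹N I
    from (∣I∣≡r , fI-basis) = trans rk≡r (sym ∣I∣≡r) , trans rk≡r (sym rkf⁻¹N⊤≡r)
      where
      rk≡r : rkf⁻¹N I ≡ r
      rk≡r = basis⊆A⇒rk≡r (λ y∈ → y∈) fI-basis

  basis⇒∣I∣≡r : ∀ I → IsBasisRk rkf⁻¹N I → ∣ I ∣ ≡ r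
  basis⇒∣I∣≡r I = proj₁ ∘ Equivalence.to (inducedBasis⇔ I)

  basis⇒image-basis : ∀ I → IsBasisRk rkf⁻¹N I → IsUnderlyingBasis G r ν (image f I)
  basis⇒image-basis I = proj₂ ∘ Equivalence.to (inducedBasis⇔ I)

  basis⇒injectiveOn : ∀ I → IsBasisRk rkf⁻¹N I → InjectiveOn f I
  basis⇒injectiveOn I I-basis =
    ∣image∣≡∣∣⇒injectiveOn
      (trans (proj₁ (basis⇒image-basis I I-basis)) (sym (basis⇒∣I∣≡r I I-basis)))

  f⁻¹ν-onBasis : ∀ I → IsBasisRk rkf⁻¹N I → f⁻¹ν I ≡ ν (image f I)
  f⁻¹ν-onBasis I I-basis =
    cong (if_then ν (image f I) else ∞ G) (dec-true (isBasisRk? rkf⁻¹N I) I-basis)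

  f⁻¹ν-offBasis : ∀ I → ¬ IsBasisRk rkf⁻¹N I → f⁻¹ν I ≡ ∞ G
  f⁻¹ν-offBasis I ¬I-basis =
    cong (if_then ν (image f I) else ∞ G) (dec-false (isBasisRk? rkf⁻¹N I) ¬I-basis)

  f⁻¹ν≢∞⇒basis : ∀ I → f⁻¹ν I ≢ ∞ G → IsBasisRk rkf⁻¹N I
  f⁻¹ν≢∞⇒basis I f⁻¹νI≢∞ with isBasisRk? rkf⁻¹N I
  ... | yes I-basis = I-basis
  ... | no ¬I-basis = contradiction (f⁻¹ν-offBasis I ¬I-basis) f⁻¹νI≢∞

  f⁻¹ν≡ν∘image : ∀ I → ∣ I ∣ ≡ r → ∣ image f I ∣ ≡ r → f⁻¹ν I ≡ ν (image f I)
  f⁻¹ν≡ν∘image I ∣I∣≡r ∣fI∣≡r with isBasisRk? rkf⁻¹N I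
  ... | yes I-basis = f⁻¹ν-onBasis I I-basis
  ... | no ¬I-basis = trans (f⁻¹ν-offBasis I ¬I-basis) (sym (¬≢∞⇒≡∞ G λ νfI≢∞ →
          ¬I-basis (Equivalence.from (inducedBasis⇔ I) (∣I∣≡r , ∣fI∣≡r , νfI≢∞))))

  f⁻¹ν-bases : ∀ I → IsUnderlyingBasis G r f⁻¹ν I ⇔ IsBasisRk rkf⁻¹N I
  f⁻¹ν-bases I = mk⇔ (f⁻¹ν≢∞⇒basis I ∘ proj₂) λ I-basis →
    basis⇒∣I∣≡r I I-basis ,
    subst (_≢ ∞ G) (sym (f⁻¹ν-onBasis I I-basis)) (proj₂ (basis⇒image-basis I I-basis))

  f⁻¹ν-nonempty : ∃ λ I → IsUnderlyingBasis G r f⁻¹ν I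
  f⁻¹ν-nonempty = I₀ , ∣I₀∣≡r , subst (_≢ ∞ G) (sym f⁻¹νI₀≡νB₀) (proj₂ B₀-basis)
    where
    section : Fin n → Fin m
    section y = proj₁ (surjective y)
    I₀ : Subset m
    I₀ = image section B₀
    fI₀≡B₀ : image f I₀ ≡ B₀
    fI₀≡B₀ = image-image-section {f = f} {g = section} (λ y → proj₂ (surjective y) refl) B₀
    ∣I₀∣≡r : ∣ I₀ ∣ ≡ r
    ∣I₀∣≡r = ≤-antisym (≤-trans (Image.∣image∣≤∣∣ section B₀) (≤-reflexive (proj₁ B₀-basis)))
      (≤-trans (≤-reflexive (trans (sym (proj₁ B₀-basis)) (cong ∣_∣ (sym fI₀≡B₀)))) (∣image∣≤∣∣ I₀))
    f⁻¹νI₀≡νB₀ : f⁻¹ν I₀ ≡ ν B₀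
    f⁻¹νI₀≡νB₀ =
      trans (f⁻¹ν≡ν∘image I₀ ∣I₀∣≡r (trans (cong ∣_∣ fI₀≡B₀) (proj₁ B₀-basis))) (cong ν fI₀≡B₀)

  f⁻¹ν-swap : ∀ I {i j} → IsBasisRk rkf⁻¹N I → i ∈ I → j ∉ I → f j ∉ image f I - f i →
              f⁻¹ν ((I - i) ∪ ⁅ j ⁆) ≡ ν ((image f I - f i) ∪ ⁅ f j ⁆)
  f⁻¹ν-swap I {i} {j} I-basis i∈I j∉I fj∉fI-fi =
    trans (f⁻¹ν≡ν∘image ((I - i) ∪ ⁅ j ⁆) ∣I'∣≡r ∣fI'∣≡r) (cong ν fI'≡)
    where
    fI'≡ : image f ((I - i) ∪ ⁅ j ⁆) ≡ (image f I - f i) ∪ ⁅ f j ⁆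
    fI'≡ = image-exchange j (basis⇒injectiveOn I I-basis) i∈I
    ∣I'∣≡r : ∣ (I - i) ∪ ⁅ j ⁆ ∣ ≡ r
    ∣I'∣≡r = trans (∣p-x∪⁅y⁆∣≡∣p∣ i∈I (j∉I ∘ p─q⊆p I ⁅ i ⁆)) (basis⇒∣I∣≡r I I-basis)
    ∣fI'∣≡r : ∣ image f ((I - i) ∪ ⁅ j ⁆) ∣ ≡ r
    ∣fI'∣≡r = trans (cong ∣_∣ fI'≡)
      (trans (∣p-x∪⁅y⁆∣≡∣p∣ (∈-image⁺ {I} i∈I) fj∉fI-fi) (proj₁ (basis⇒image-basis I I-basis)))

  f⁻¹ν-swap-within-fibre : ∀ I {i j} → IsBasisRk rkf⁻¹N I → i ∈ I → j ∉ I → f j ≡ f i →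
                           f⁻¹ν ((I - i) ∪ ⁅ j ⁆) ≡ f⁻¹ν I
  f⁻¹ν-swap-within-fibre I {i} {j} I-basis i∈I j∉I fj≡fi = begin
    f⁻¹ν ((I - i) ∪ ⁅ j ⁆)             ≡⟨ f⁻¹ν-swap I I-basis i∈I j∉I fj∉fI-fi ⟩
    ν ((image f I - f i) ∪ ⁅ f j ⁆)    ≡⟨ cong (λ y → ν ((image f I - f i) ∪ ⁅ y ⁆)) fj≡fi ⟩
    ν ((image f I - f i) ∪ ⁅ f i ⁆)    ≡⟨ cong ν (p-x∪⁅x⁆≡p (∈-image⁺ {I} i∈I)) ⟩
    ν (image f I)                      ≡⟨ f⁻¹ν-onBasis I I-basis ⟨
    f⁻¹ν I                             ∎
    where
    open ≡-Reasoning
    fj∉fI-fi : f j ∉ image f I - f i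
    fj∉fI-fi = subst (_∉ image f I - f i) (sym fj≡fi) (x∉p-x {p = image f I})

  exchange-bases : SatisfiesExchange G r ν → ∀ {I J i} → IsBasisRk rkf⁻¹N I → IsBasisRk rkf⁻¹N J →
                   i ∈ I → i ∉ J → ExchangePartner G f⁻¹ν I J i
  exchange-bases ν-exchange {I} {J} {i} I-basis J-basis i∈I i∉J with f i ∈? image f J
  ... | yes fi∈fJ with ∈-image⁻ {J} fi∈fJ
  ...   | j , j∈J , fj≡fi = j , j∈J , j∉I ,
          subst (λ a → _≤𝕋_ G a (_⊕_ G (f⁻¹ν I) (f⁻¹ν J)))
            (sym (cong₂ (_⊕_ G) (f⁻¹ν-swap-within-fibre I I-basis i∈I j∉I fj≡fi)
                                (f⁻¹ν-swap-within-fibre J J-basis j∈J i∉J (sym fj≡fi))))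
            (≤𝕋-refl G _)
    where
    j∉I : j ∉ I
    j∉I j∈I = i∉J (subst (_∈ J) (basis⇒injectiveOn I I-basis j∈I i∈I fj≡fi) j∈J)
  exchange-bases ν-exchange {I} {J} {i} I-basis J-basis i∈I i∉J | no fi∉fJ
    with ν-exchange (image f I) (image f J) (f i)
           (proj₁ (basis⇒image-basis I I-basis)) (proj₁ (basis⇒image-basis J J-basis))
           (∈-image⁺ {I} i∈I) fi∉fJ
  ... | y , y∈fJ , y∉fI , ν-inequality with ∈-image⁻ {J} y∈fJ
  ...   | j , j∈J , refl = j , j∈J , y∉fI ∘ ∈-image⁺ {I} ,
          subst₂ (_≤𝕋_ G)
            (sym (cong₂ (_⊕_ G) (f⁻¹ν-swap I I-basis i∈I (y∉fI ∘ ∈-image⁺ {I}) (y∉fI ∘ p─q⊆p _ _))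
                                (f⁻¹ν-swap J J-basis j∈J i∉J (fi∉fJ ∘ p─q⊆p _ _))))
            (sym (cong₂ (_⊕_ G) (f⁻¹ν-onBasis I I-basis) (f⁻¹ν-onBasis J J-basis)))
            ν-inequality

  exchange-degenerate : ∀ {I J i} → ∣ I ∣ ≡ r → ∣ J ∣ ≡ r → i ∈ I → i ∉ J →
                        _⊕_ G (f⁻¹ν I) (f⁻¹ν J) ≡ ∞ G → ExchangePartner G f⁻¹ν I J i
  exchange-degenerate ∣I∣≡r ∣J∣≡r i∈I i∉J sum≡∞
    with ∣p∣≤∣q∣∧p⊈q⇒q⊈p (≤-reflexive (trans ∣I∣≡r (sym ∣J∣≡r))) i∈I i∉J
  ... | j , j∈J , j∉I = j , j∈J , j∉I , subst (_≤𝕋_ G _) (sym sum≡∞) (_ ≤∞)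

  f⁻¹ν-exchange : SatisfiesExchange G r ν → SatisfiesExchange G r f⁻¹ν
  f⁻¹ν-exchange ν-exchange I J i ∣I∣≡r ∣J∣≡r i∈I i∉J with isBasisRk? rkf⁻¹N I | isBasisRk? rkf⁻¹N J
  ... | yes I-basis | yes J-basis = exchange-bases ν-exchange I-basis J-basis i∈I i∉J
  ... | no ¬I-basis | _ =
    exchange-degenerate ∣I∣≡r ∣J∣≡r i∈I i∉J
      (cong (λ a → _⊕_ G a (f⁻¹ν J)) (f⁻¹ν-offBasis I ¬I-basis))
  ... | yes _ | no ¬J-basis =
    exchange-degenerate ∣I∣≡r ∣J∣≡r i∈I i∉J
      (trans (cong (_⊕_ G (f⁻¹ν I)) (f⁻¹ν-offBasis J ¬J-basis)) (⊕-zeroʳ G (f⁻¹ν I)))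

proposition3p18 : (G : OrderedAbelianGroup) {m n r : ℕ} (f : Fin m → Fin n) →
    Surjective _≡_ _≡_ f → (ν : Subset n → 𝕋 G) → IsValuatedMatroid G n r ν →
    IsValuatedMatroid G m r (pullback G f r ν)
    × (∀ (I : Subset m) →
         (∣ I ∣ ≡ r × pullback G f r ν I ≢ ∞ G)
           ⇔ IsBasisRk (inducedRank f (rankUnderlying G r ν)) I)
proposition3p18 G f surjective ν ((B₀ , B₀-basis) , ν-exchange) =
  (f⁻¹ν-nonempty , f⁻¹ν-exchange ν-exchange) , f⁻¹ν-bases
  where open InducedValuation G f surjective ν B₀-basis
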